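{- Let $G$ be a graph, let $\{x,y\}\subseteq V(G)$ be a separating set of $G$, and let $H$ be a component of $G-\{x,y\}$. If $H$ contains no vertex that is a common neighbor of $x$ and $y$, then $G$ has no locally connected spanning tree.
   Context: All graphs are finite and simple. A separating set of a graph $G$ is a set $S\subseteq V(G)$ such that $G-S$ has more than one component. A locally connected spanning tree of $G$ is a spanning tree $T$ of $G$ such that for every vertex $v\in V(G)$, the set $N_T(v)$ of neighbors of $v$ in $T$ induces a connected subgraph of $G$. -}

module Defs where

open import Data.Nat using (ℕ; suc)
open import Data.Fin using (Fin; zero; suc; inject₁; fromℕ)
open import Data.Product using (Σ; _×_; ∃-syntax)
open import Relation.Binary.PropositionalEquality using (_≡_)
open import Relation.Nullary using (¬_)
open import Function.Definitions using (Injective)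
open import Data.Unit using (⊤)

record Graph : Set₁ where
  field
    n       : ℕ
    Adj     : Fin n → Fin n → Set
    sym     : ∀ {u v} → Adj u v → Adj v u
    irrefl  : ∀ {v} → ¬ Adj v v
open Graph public

-- Walks using edges of E whose vertices all satisfy P (walk in the subgraph induced by P).
data Walk {m : ℕ} (E : Fin m → Fin m → Set) (P : Fin m → Set) : Fin m → Fin m → Set where
  [_]  : ∀ {a} → P a → Walk E P a a
  _∷⟨_⟩_ : ∀ {a b c} → P a → E a b → Walk E P b c → Walk E P a c

Outside : ∀ {m} → Fin m → Fin m → Fin m → Set
Outside x y v = ¬ (v ≡ x) × ¬ (v ≡ y)

-- {x,y} is a separating set: G - {x,y} has more than one component,
-- i.e. two vertices of G - {x,y} not joined by a walk in G - {x,y}.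
Separating : (G : Graph) → Fin (n G) → Fin (n G) → Set
Separating G x y =
  ∃[ u ] ∃[ v ] (Outside x y u × Outside x y v × ¬ Walk (Adj G) (Outside x y) u v)

-- The component of G - {x,y} containing the vertex h (h ∉ {x,y}):
-- its vertices are those reachable from h by a walk in G - {x,y}.
InComponent : (G : Graph) (x y h : Fin (n G)) → Fin (n G) → Set
InComponent G x y h w = Walk (Adj G) (Outside x y) h w

record Cycle {m : ℕ} (T : Fin m → Fin m → Set) : Set where
  field
    k     : ℕ
    c     : Fin (suc (suc (suc k))) → Fin m
    inj   : Injective _≡_ _≡_ c
    step  : ∀ (i : Fin (suc (suc k))) → T (c (inject₁ i)) (c (suc i))
    close : T (c (fromℕ (suc (suc k)))) (c zero)

Everything : ∀ {m} → Fin m → Set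
Everything _ = ⊤

record SpanningTree (G : Graph) (T : Fin (n G) → Fin (n G) → Set) : Set where
  field
    sub       : ∀ {u v} → T u v → Adj G u v
    symT      : ∀ {u v} → T u v → T v u
    connected : ∀ u v → Walk T Everything u v
    acyclic   : ¬ Cycle T

-- N_T(v) induces a connected subgraph of G.
NbhdConnected : (G : Graph) (T : Fin (n G) → Fin (n G) → Set) → Fin (n G) → Set
NbhdConnected G T v = ∀ a b → T v a → T v b → Walk (Adj G) (T v) a b

record LocallyConnectedSpanningTree (G : Graph) : Set₁ where
  field
    T        : Fin (n G) → Fin (n G) → Set
    tree     : SpanningTree G T
    locConn  : ∀ v → NbhdConnected G T v

-- A tree edge
-- leaves H only towards x or y.  For z ∈ {x, y}, a walk in G through N_T(z) that
-- starts in H cannot leave H: its first vertex outside H would be the other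
-- separator vertex, making its predecessor in H a common neighbour of x and y.
-- Hence H together with those of x, y having a tree neighbour in H is closed
-- under tree edges; as T spans G, all of G - {x, y} lies in H, contradicting
-- that {x, y} separates G.

module Submission where

open import Defs
open import Data.Nat using (ℕ)
open import Data.Fin using (Fin; _≟_)
open import Data.Product using (_×_; _,_; proj₁; proj₂; ∃-syntax)
open import Data.Sum using (_⊎_; inj₁; inj₂)
open import Data.Empty using (⊥-elim)
open import Relation.Nullary using (¬_; yes; no)
open import Relation.Binary.PropositionalEquality using (_≡_; refl)

module _ {m : ℕ} {E : Fin m → Fin m → Set} {P : Fin m → Set} where

  Walk-head : ∀ {a b} → Walk E P a b → P a
  Walk-head [ pa ]         = pa
  Walk-head (pa ∷⟨ _ ⟩ _) = pa

  _∷ʳ⟨_⟩_ : ∀ {a b c} → Walk E P a b → E b c → P c → Walk E P a c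
  [ pa ]          ∷ʳ⟨ e ⟩ pc = pa ∷⟨ e ⟩ [ pc ]
  (pa ∷⟨ e′ ⟩ w) ∷ʳ⟨ e ⟩ pc = pa ∷⟨ e′ ⟩ (w ∷ʳ⟨ e ⟩ pc)

  _++ᵂ_ : ∀ {a b c} → Walk E P a b → Walk E P b c → Walk E P a c
  [ _ ]          ++ᵂ w′ = w′
  (pa ∷⟨ e ⟩ w) ++ᵂ w′ = pa ∷⟨ e ⟩ (w ++ᵂ w′)

  Walk-reverse : (∀ {u v} → E u v → E v u) → ∀ {a b} → Walk E P a b → Walk E P b a
  Walk-reverse E-sym [ pa ]         = [ pa ]
  Walk-reverse E-sym (pa ∷⟨ e ⟩ w) = Walk-reverse E-sym w ∷ʳ⟨ E-sym e ⟩ pa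

  Walk-preserves : {Q : Fin m → Set} →
                   (∀ {a b} → P a → E a b → P b → Q a → Q b) →
                   ∀ {a b} → Walk E P a b → Q a → Q b
  Walk-preserves step [ _ ]          qa = qa
  Walk-preserves step (pa ∷⟨ e ⟩ w) qa =
    Walk-preserves step w (step pa e (Walk-head w) qa)

module Separation (G : Graph) (x y h : Fin (n G))
  (no-common-neighbour : ∀ w → InComponent G x y h w → ¬ (Adj G w x × Adj G w y)) where

  H : Fin (n G) → Set
  H = InComponent G x y h

  Separator : Fin (n G) → Set
  Separator z = z ≡ x ⊎ z ≡ y

  separator-or-outside : ∀ z → Separator z ⊎ Outside x y z
  separator-or-outside z with z ≟ x | z ≟ y
  ... | yes z≡x | _       = inj₁ (inj₁ z≡x)
  ... | no _    | yes z≡y = inj₁ (inj₂ z≡y)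
  ... | no z≢x  | no z≢y  = inj₂ (z≢x , z≢y)

  distinct-separator-vertices : {Q : Fin (n G) → Set} {z b : Fin (n G)} →
    Separator z → Separator b → ¬ z ≡ b → Q z → Q b → Q x × Q y
  distinct-separator-vertices (inj₁ refl) (inj₁ refl) z≢b _  _  = ⊥-elim (z≢b refl)
  distinct-separator-vertices (inj₁ refl) (inj₂ refl) _   qz qb = qz , qb
  distinct-separator-vertices (inj₂ refl) (inj₁ refl) _   qz qb = qb , qz
  distinct-separator-vertices (inj₂ refl) (inj₂ refl) z≢b _  _  = ⊥-elim (z≢b refl)

  module _ (T : Fin (n G) → Fin (n G) → Set) (T⊆G : ∀ {u v} → T u v → Adj G u v) where

    separator-neighbourhood-stays-in-H : ∀ {z a b} → Separator z →
      Walk (Adj G) (T z) a b → H a → H b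
    separator-neighbourhood-stays-in-H {z} sz = Walk-preserves step
      where
      step : ∀ {a b} → T z a → Adj G a b → T z b → H a → H b
      step {a} {b} tza e tzb ha with separator-or-outside b
      ... | inj₂ ob = ha ∷ʳ⟨ e ⟩ ob
      ... | inj₁ sb = ⊥-elim (no-common-neighbour a ha
              (distinct-separator-vertices sz sb z≢b (Graph.sym G (T⊆G tza)) e))
        where
        z≢b : ¬ z ≡ b
        z≢b refl = Graph.irrefl G (T⊆G tzb)

    AttachedToH : Fin (n G) → Set
    AttachedToH w = H w ⊎ (Separator w × ∃[ a ] (H a × T w a))

    tree-edge-preserves-AttachedToH :
      (∀ {u v} → T u v → T v u) → (∀ v → NbhdConnected G T v) →
      ∀ {w w′} → AttachedToH w → T w w′ → AttachedToH w′
    tree-edge-preserves-AttachedToH T-sym locConn {w} {w′} (inj₁ hw) t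
      with separator-or-outside w′
    ... | inj₁ sw′ = inj₂ (sw′ , w , hw , T-sym t)
    ... | inj₂ ow′ = inj₁ (hw ∷ʳ⟨ T⊆G t ⟩ ow′)
    tree-edge-preserves-AttachedToH T-sym locConn {w} {w′} (inj₂ (sw , a , ha , ta)) t =
      inj₁ (separator-neighbourhood-stays-in-H sw (locConn w a w′ ta t) ha)

  H-contains-Outside : Outside x y h → LocallyConnectedSpanningTree G →
    ∀ {w} → Outside x y w → H w
  H-contains-Outside oh L {w} ow =
    attached-outside-in-H (Walk-preserves step (connected h w) (inj₁ [ oh ]))
    where
    open LocallyConnectedSpanningTree L
    open SpanningTree tree

    step : ∀ {a b} → Everything a → T a b → Everything b →
           AttachedToH T sub a → AttachedToH T sub b
    step _ t _ q = tree-edge-preserves-AttachedToH T sub symT locConn q t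

    attached-outside-in-H : AttachedToH T sub w → H w
    attached-outside-in-H (inj₁ hw)              = hw
    attached-outside-in-H (inj₂ (inj₁ refl , _)) = ⊥-elim (proj₁ ow refl)
    attached-outside-in-H (inj₂ (inj₂ refl , _)) = ⊥-elim (proj₂ ow refl)

lemma2 : (G : Graph) (x y : Fin (n G)) → Separating G x y →
    (h : Fin (n G)) → Outside x y h →
    (∀ w → InComponent G x y h w → ¬ (Adj G w x × Adj G w y)) →
    ¬ LocallyConnectedSpanningTree G
lemma2 G x y (u , v , ou , ov , no-walk) h oh no-common L =
  no-walk (Walk-reverse (Graph.sym G) (H-contains-Outside oh L ou)
           ++ᵂ H-contains-Outside oh L ov)
  where open Separation G x y h no-common
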